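{- If $w$ is a Baxter permutation of length $n$ that is fixed under $90^{\circ}$ rotation, then $n$ is odd.
   Context: A permutation $w=w_1\ldots w_n$ is a Baxter permutation if there are no indices $i<j<j+1<k$ with $w_j<w_k<w_i<w_{j+1}$ (pattern 3-14-2) and no indices $i<j<j+1<k$ with $w_{j+1}<w_i<w_k<w_j$ (pattern 2-41-3). A permutation $w$ of length $n$ is fixed under $90^{\circ}$ rotation (of its permutation matrix) if for all $i$, $w_i=j$ implies $w_j=n+1-i$ (equivalently $w_{w_i}=n+1-i$ for all $i$). -}

module Defs where

open import Data.Nat using (ℕ)
open import Data.Fin using (Fin; toℕ; opposite; _<_)
open import Data.Fin.Permutation using (Permutation′; _⟨$⟩ʳ_)
open import Data.Nat using (suc)
open import Data.Product using (_×_)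
open import Relation.Binary.PropositionalEquality using (_≡_)
open import Relation.Nullary using (¬_)

-- Permutations of length n are bijections of Fin n (0-based positions
-- and values); w_i is  w ⟨$⟩ʳ i .

Has3-14-2 : {n : ℕ} → Permutation′ n → Set
Has3-14-2 {n} w =
  Σ' where
  open import Data.Product using (∃-syntax)
  Σ' : Set
  Σ' = ∃[ i ] ∃[ j ] ∃[ j' ] ∃[ k ]
         (i < j × toℕ j' ≡ suc (toℕ j) × j' < k ×
          (w ⟨$⟩ʳ j) < (w ⟨$⟩ʳ k) × (w ⟨$⟩ʳ k) < (w ⟨$⟩ʳ i) ×
          (w ⟨$⟩ʳ i) < (w ⟨$⟩ʳ j'))

Has2-41-3 : {n : ℕ} → Permutation′ n → Set
Has2-41-3 {n} w =
  Σ' where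
  open import Data.Product using (∃-syntax)
  Σ' : Set
  Σ' = ∃[ i ] ∃[ j ] ∃[ j' ] ∃[ k ]
         (i < j × toℕ j' ≡ suc (toℕ j) × j' < k ×
          (w ⟨$⟩ʳ j') < (w ⟨$⟩ʳ i) × (w ⟨$⟩ʳ i) < (w ⟨$⟩ʳ k) ×
          (w ⟨$⟩ʳ k) < (w ⟨$⟩ʳ j))

IsBaxter : {n : ℕ} → Permutation′ n → Set
IsBaxter w = ¬ Has3-14-2 w × ¬ Has2-41-3 w

-- Fixed under 90° rotation: w_{w_i} = n+1-i (1-based), i.e. with
-- 0-based Fin n: w (w i) = opposite i  (toℕ (opposite i) = n - 1 - toℕ i).
IsRotationFixed : {n : ℕ} → Permutation′ n → Set
IsRotationFixed w = ∀ i → w ⟨$⟩ʳ (w ⟨$⟩ʳ i) ≡ opposite i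

-- Rotation by 90° has order four, so w permutes the positions in 4-cycles
-- j ↦ w j ↦ opposite j ↦ opposite (w j) ↦ j.  When n is even the two middle
-- positions j and j + 1 = opposite j are adjacent; take their cycle and let
-- a = w j.  If a < j, the positions a < j < j + 1 < opposite a carry the
-- values a, j, j + 1, opposite a, a 3-14-2 pattern; if a > j + 1, the
-- positions opposite a < j < j + 1 < a form a 2-41-3 pattern; a ∈ {j, j + 1}
-- contradicts w a = j + 1.
module Submission where

open import Defs
open import Data.Nat using (ℕ; suc)
open import Data.Nat.Divisibility using (_∣_; divides)
open import Data.Fin.Permutation using (Permutation′; _⟨$⟩ʳ_)
open import Relation.Nullary using (¬_)

open import Data.Nat as ℕ using (_+_; _∸_; _*_)
open import Data.Nat.Properties as ℕ
  using (∸-monoʳ-<; m≤m+n; m+n∸m≡n; +-suc; *-comm; +-identityʳ; suc-injective; <⇒≱; ≤-refl)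
open import Data.Fin using (Fin; toℕ; fromℕ<; opposite; _<_)
open import Data.Fin.Properties
  using (toℕ-fromℕ<; toℕ<n; opposite-prop; opposite-involutive; <-cmp; <-irrefl)
open import Data.Product using (∃; _,_)
open import Relation.Binary.Definitions using (tri<; tri≈; tri>)
open import Relation.Binary.PropositionalEquality
  using (_≡_; sym; trans; cong; subst; subst₂; module ≡-Reasoning)

opposite-reverses-< : ∀ {n} {i j : Fin n} → i < j → opposite j < opposite i
opposite-reverses-< {n} {i} {j} i<j =
  subst₂ ℕ._<_ (sym (opposite-prop j)) (sym (opposite-prop i))
    (∸-monoʳ-< (ℕ.s≤s i<j) (toℕ<n j))

module RotationFixed {n : ℕ} (w : Permutation′ n) (rot : IsRotationFixed w) where

  w-opposite : ∀ x → w ⟨$⟩ʳ opposite x ≡ opposite (w ⟨$⟩ʳ x)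
  w-opposite x = trans (cong (w ⟨$⟩ʳ_) (sym (rot x))) (rot (w ⟨$⟩ʳ x))

  w-opposite-w : ∀ x → w ⟨$⟩ʳ opposite (w ⟨$⟩ʳ x) ≡ x
  w-opposite-w x = begin
    w ⟨$⟩ʳ opposite (w ⟨$⟩ʳ x)   ≡⟨ w-opposite (w ⟨$⟩ʳ x) ⟩
    opposite (w ⟨$⟩ʳ (w ⟨$⟩ʳ x)) ≡⟨ cong opposite (rot x) ⟩
    opposite (opposite x)        ≡⟨ opposite-involutive x ⟩
    x                            ∎
    where open ≡-Reasoning

  module _ (j : Fin n) (adjacent : toℕ (opposite j) ≡ suc (toℕ j)) where
    private
      j′ = opposite j
      a  = w ⟨$⟩ʳ j
      a′ = opposite a

      j<j′ : j < j′
      j<j′ = subst (toℕ j ℕ.<_) (sym adjacent) ≤-refl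

      ¬between : j < a → ¬ (a < j′)
      ¬between j<a a<j′ = <⇒≱ j<a (ℕ.s≤s⁻¹ (subst (toℕ a ℕ.<_) adjacent a<j′))

      w-a≡j′ : w ⟨$⟩ʳ a ≡ j′
      w-a≡j′ = rot j

      w-j′≡a′ : w ⟨$⟩ʳ j′ ≡ a′
      w-j′≡a′ = w-opposite j

      w-a′≡j : w ⟨$⟩ʳ a′ ≡ j
      w-a′≡j = w-opposite-w j

      a≢j : ¬ (a ≡ j)
      a≢j a≡j = <-irrefl (sym (begin
        j′           ≡⟨ w-a≡j′ ⟨
        w ⟨$⟩ʳ a     ≡⟨ cong (w ⟨$⟩ʳ_) a≡j ⟩
        a            ≡⟨ a≡j ⟩
        j            ∎)) j<j′
        where open ≡-Reasoning

      a≢j′ : ¬ (a ≡ j′)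
      a≢j′ a≡j′ = <-irrefl (sym (begin
        j′           ≡⟨ w-a≡j′ ⟨
        w ⟨$⟩ʳ a     ≡⟨ cong (w ⟨$⟩ʳ_) a≡j′ ⟩
        w ⟨$⟩ʳ j′    ≡⟨ w-j′≡a′ ⟩
        opposite a   ≡⟨ cong opposite a≡j′ ⟩
        opposite j′  ≡⟨ opposite-involutive j ⟩
        j            ∎)) j<j′
        where open ≡-Reasoning

      3-14-2-below : a < j → Has3-14-2 w
      3-14-2-below a<j =
        a , j , j′ , a′ , a<j , adjacent , j′<a′ ,
        subst (a <_) (sym w-a′≡j) a<j ,
        subst₂ _<_ (sym w-a′≡j) (sym w-a≡j′) j<j′ ,
        subst₂ _<_ (sym w-a≡j′) (sym w-j′≡a′) j′<a′
        where
        j′<a′ : j′ < a′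
        j′<a′ = opposite-reverses-< a<j

      2-41-3-above : j′ < a → Has2-41-3 w
      2-41-3-above j′<a =
        a′ , j , j′ , a , a′<j , adjacent , j′<a ,
        subst₂ _<_ (sym w-j′≡a′) (sym w-a′≡j) a′<j ,
        subst₂ _<_ (sym w-a′≡j) (sym w-a≡j′) j<j′ ,
        subst (_< a) (sym w-a≡j′) j′<a
        where
        a′<j : a′ < j
        a′<j = subst (a′ <_) (opposite-involutive j) (opposite-reverses-< j′<a)

    ¬Baxter-at-adjacent-opposite : ¬ IsBaxter w
    ¬Baxter-at-adjacent-opposite (no3-14-2 , no2-41-3) with <-cmp a j
    ... | tri< a<j _ _   = no3-14-2 (3-14-2-below a<j)
    ... | tri≈ _ a≡j _   = a≢j a≡j
    ... | tri> _ _ j<a with <-cmp a j′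
    ... | tri< a<j′ _ _  = ¬between j<a a<j′
    ... | tri≈ _ a≡j′ _  = a≢j′ a≡j′
    ... | tri> _ _ j′<a  = no2-41-3 (2-41-3-above j′<a)

middle-position : ∀ h → ∃ λ (j : Fin (suc (h + suc h))) → toℕ (opposite j) ≡ suc (toℕ j)
middle-position h = j , (begin
    toℕ (opposite j)     ≡⟨ opposite-prop j ⟩
    h + suc h ∸ toℕ j    ≡⟨ cong (h + suc h ∸_) (toℕ-fromℕ< h<n) ⟩
    h + suc h ∸ h        ≡⟨ m+n∸m≡n h (suc h) ⟩
    suc h                ≡⟨ cong suc (toℕ-fromℕ< h<n) ⟨
    suc (toℕ j)          ∎)
  where
  open ≡-Reasoning
  h<n = ℕ.s≤s (m≤m+n h (suc h))
  j = fromℕ< h<n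

suc-double : ∀ {m h} → suc m ≡ suc h * 2 → m ≡ h + suc h
suc-double {m} {h} m+1≡2h+2 = begin
  m             ≡⟨ suc-injective m+1≡2h+2 ⟩
  suc (h * 2)   ≡⟨ cong suc (trans (*-comm h 2) (cong (h +_) (+-identityʳ h))) ⟩
  suc (h + h)   ≡⟨ +-suc h h ⟨
  h + suc h     ∎
  where open ≡-Reasoning

even⇒middle-position : ∀ {m} → 2 ∣ suc m → ∃ λ (j : Fin (suc m)) → toℕ (opposite j) ≡ suc (toℕ j)
even⇒middle-position (divides (suc h) m+1≡2h+2) rewrite suc-double m+1≡2h+2 = middle-position h

lemma5p2 : (m : ℕ) (w : Permutation′ (suc m)) → IsBaxter w → IsRotationFixed w → ¬ (2 ∣ suc m)
lemma5p2 m w baxter rot even with even⇒middle-position even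
... | j , adjacent = RotationFixed.¬Baxter-at-adjacent-opposite w rot j adjacent baxter
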